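{- Let $\varphi$ be an LTL formula and $B$ a finite basis. Assume that for every $C\subseteq B$ there exists a formula $\varphi_C$ such that (i) $\varphi$ and $\varphi_C$ are equivalent under context $\langle C,B\rangle$, and (ii) for all $C\subseteq C'\subseteq B$, $\varphi_C\models\varphi_{C'}$. Then $$\varphi\equiv\bigvee_{C\subseteq B}\Big(\varphi_C\wedge\bigwedge_{\psi\in C}\psi\Big).$$
   Context: LTL formulas are interpreted on infinite words over $2^{Ap}$ ($Ap$ finite); $\varphi\equiv\psi$ means equal sets of models, $\varphi\models\psi$ means every model of $\varphi$ is a model of $\psi$. A basis is a set $B$ of formulas; for $C\subseteq B$, $\mathcal L\langle C,B\rangle$ is the set of words satisfying every formula of $C$ and no formula of $B\setminus C$; two formulas are equivalent under context $\langle C,B\rangle$ if they are satisfied by exactly the same words of $\mathcal L\langle C,B\rangle$. -}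

module Defs where

open import Data.Nat using (ℕ; zero; suc; _+_; _<_; _≤_)
open import Data.Bool using (Bool; true; false)
open import Data.Fin using (Fin)
open import Data.Vec using (Vec; []; _∷_; lookup)
open import Data.List using (List; []; _∷_; _++_; map; foldr)
open import Data.Fin.Subset using (Subset; _∈_; _∉_; _⊆_; inside; outside)
open import Data.Product using (Σ; ∃; _×_; _,_)
open import Data.Sum using (_⊎_)
open import Data.Empty using (⊥)
open import Data.Unit using (⊤)
open import Relation.Nullary using (¬_)
open import Relation.Binary.PropositionalEquality using (_≡_)

-- Atomic propositions: Ap = Fin n (finite).  A letter is an element of 2^Ap,
-- represented by its characteristic function.  A word is an infinite
-- sequence of letters.
Letter : ℕ → Set
Letter n = Fin n → Bool

Word : ℕ → Set
Word n = ℕ → Letter n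

suffix : ∀ {n} → Word n → ℕ → Word n
suffix w i = λ j → w (i + j)

-- LTL syntax (full LTL: atoms, true/false, negation, conjunction,
-- disjunction, next, until; derived operators F, G, R definable from these).
infixr 6 _∧ₗ_
infixr 5 _∨ₗ_
data LTL (n : ℕ) : Set where
  ttₗ  : LTL n
  ffₗ  : LTL n
  atom : Fin n → LTL n
  ¬ₗ_  : LTL n → LTL n
  _∧ₗ_ : LTL n → LTL n → LTL n
  _∨ₗ_ : LTL n → LTL n → LTL n
  Xₗ   : LTL n → LTL n
  _Uₗ_ : LTL n → LTL n → LTL n

infix 4 _⊨_
_⊨_ : ∀ {n} → Word n → LTL n → Set
w ⊨ ttₗ     = ⊤
w ⊨ ffₗ     = ⊥
w ⊨ atom a  = w 0 a ≡ true
w ⊨ ¬ₗ φ    = ¬ (w ⊨ φ)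
w ⊨ φ ∧ₗ ψ  = (w ⊨ φ) × (w ⊨ ψ)
w ⊨ φ ∨ₗ ψ  = (w ⊨ φ) ⊎ (w ⊨ ψ)
w ⊨ Xₗ φ    = suffix w 1 ⊨ φ
w ⊨ φ Uₗ ψ  = ∃ λ k → (suffix w k ⊨ ψ) × (∀ j → j < k → suffix w j ⊨ φ)

infix 3 _≡ₗ_ _⊨ₗ_
_≡ₗ_ : ∀ {n} → LTL n → LTL n → Set
φ ≡ₗ ψ = ∀ w → ((w ⊨ φ → w ⊨ ψ) × (w ⊨ ψ → w ⊨ φ))

_⊨ₗ_ : ∀ {n} → LTL n → LTL n → Set
φ ⊨ₗ ψ = ∀ w → w ⊨ φ → w ⊨ ψ

-- A finite basis B is a vector of m formulas; a sub-basis C ⊆ B is a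
-- subset of the index set Fin m.
Basis : ℕ → ℕ → Set
Basis n m = Vec (LTL n) m

InContext : ∀ {n m} → Basis n m → Subset m → Word n → Set
InContext B C w = ∀ i → (i ∈ C → w ⊨ lookup B i) × (i ∉ C → ¬ (w ⊨ lookup B i))

EquivUnder : ∀ {n m} → Basis n m → Subset m → LTL n → LTL n → Set
EquivUnder B C φ ψ =
  ∀ w → InContext B C w → ((w ⊨ φ → w ⊨ ψ) × (w ⊨ ψ → w ⊨ φ))

allSubsets : ∀ m → List (Subset m)
allSubsets zero    = [] ∷ []
allSubsets (suc m) = map (inside ∷_) (allSubsets m) ++ map (outside ∷_) (allSubsets m)

⋀ : ∀ {n} → List (LTL n) → LTL n
⋀ = foldr _∧ₗ_ ttₗ

⋁ : ∀ {n} → List (LTL n) → LTL n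
⋁ = foldr _∨ₗ_ ffₗ

selected : ∀ {n m} → Basis n m → Subset m → List (LTL n)
selected []       []            = []
selected (ψ ∷ B)  (inside ∷ C)  = ψ ∷ selected B C
selected (ψ ∷ B)  (outside ∷ C) = selected B C

decomposition : ∀ {n m} → Basis n m → (Subset m → LTL n) → LTL n
decomposition {m = m} B φ_ = ⋁ (map (λ C → φ_ C ∧ₗ ⋀ (selected B C)) (allSubsets m))

{-# OPTIONS --safe #-}
module Submission where

-- A word w lies in the context ⟨C_w, B⟩ where C_w collects the basis formulas
-- it satisfies (deciding each of them needs excluded middle).  There φ agrees
-- with φ_{C_w}, and w satisfies the disjunct for C_w.  Conversely, if w
-- satisfies the disjunct φ_C ∧ ⋀ C, then C ⊆ C_w, so monotonicity gives
-- φ_{C_w} and hence φ.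

open import Defs
open import Data.Nat using (ℕ; suc)
open import Data.Fin using (zero; suc)
open import Data.Fin.Subset using (Subset; _∈_; _⊆_; inside; outside)
open import Data.Vec using ([]; _∷_; lookup; here; there)
open import Data.List using (List; _∷_; map)
open import Data.List.Relation.Unary.Any using (Any; satisfied)
import Data.List.Relation.Unary.Any as Any
open import Data.List.Relation.Unary.Any.Properties using (map⁺; map⁻)
import Data.List.Membership.Propositional as List
open import Data.List.Membership.Propositional using (lose)
open import Data.List.Membership.Propositional.Properties using (∈-map⁺; ∈-++⁺ˡ; ∈-++⁺ʳ)
open import Data.Product using (_,_; proj₁; proj₂)
open import Data.Sum using (inj₁; inj₂)
open import Data.Unit using (tt)
open import Data.Empty using (⊥-elim)
open import Level using (0ℓ)
open import Axiom.ExcludedMiddle using (ExcludedMiddle)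
open import Relation.Nullary using (does; yes; no)
open import Relation.Binary.PropositionalEquality using (refl)

∈-allSubsets : ∀ {m} (C : Subset m) → C List.∈ allSubsets m
∈-allSubsets []            = Any.here refl
∈-allSubsets (inside ∷ C)  = ∈-++⁺ˡ (∈-map⁺ (inside ∷_) (∈-allSubsets C))
∈-allSubsets {suc m} (outside ∷ C) =
  ∈-++⁺ʳ (map (inside ∷_) (allSubsets m)) (∈-map⁺ (outside ∷_) (∈-allSubsets C))

module _ {n : ℕ} (w : Word n) where

  ⊨⋁⁺ : ∀ {φs : List (LTL n)} → Any (w ⊨_) φs → w ⊨ ⋁ φs
  ⊨⋁⁺ (Any.here p)  = inj₁ p
  ⊨⋁⁺ (Any.there p) = inj₂ (⊨⋁⁺ p)

  ⊨⋁⁻ : ∀ (φs : List (LTL n)) → w ⊨ ⋁ φs → Any (w ⊨_) φs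
  ⊨⋁⁻ (φ ∷ φs) (inj₁ p) = Any.here p
  ⊨⋁⁻ (φ ∷ φs) (inj₂ p) = Any.there (⊨⋁⁻ φs p)

  ⊨⋀-selected⁺ : ∀ {m} (B : Basis n m) (C : Subset m) →
                 (∀ {i} → i ∈ C → w ⊨ lookup B i) → w ⊨ ⋀ (selected B C)
  ⊨⋀-selected⁺ []      []            _   = tt
  ⊨⋀-selected⁺ (ψ ∷ B) (inside ∷ C)  sat = sat here , ⊨⋀-selected⁺ B C (λ p → sat (there p))
  ⊨⋀-selected⁺ (ψ ∷ B) (outside ∷ C) sat = ⊨⋀-selected⁺ B C (λ p → sat (there p))

  ⊨⋀-selected⁻ : ∀ {m} (B : Basis n m) (C : Subset m) →
                 w ⊨ ⋀ (selected B C) → ∀ {i} → i ∈ C → w ⊨ lookup B i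
  ⊨⋀-selected⁻ (ψ ∷ B) (inside ∷ C)  (p , _)  here      = p
  ⊨⋀-selected⁻ (ψ ∷ B) (inside ∷ C)  (_ , ps) (there i) = ⊨⋀-selected⁻ B C ps i
  ⊨⋀-selected⁻ (ψ ∷ B) (outside ∷ C) ps       (there i) = ⊨⋀-selected⁻ B C ps i

  module _ (em : ExcludedMiddle 0ℓ) where

    satisfiedSubset : ∀ {m} → Basis n m → Subset m
    satisfiedSubset []      = []
    satisfiedSubset (ψ ∷ B) = does (em {w ⊨ ψ}) ∷ satisfiedSubset B

    ∈-satisfiedSubset⁺ : ∀ {m} (B : Basis n m) {i} → w ⊨ lookup B i → i ∈ satisfiedSubset B
    ∈-satisfiedSubset⁺ (ψ ∷ B) {zero} p with em {w ⊨ ψ}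
    ... | yes _ = here
    ... | no ¬p = ⊥-elim (¬p p)
    ∈-satisfiedSubset⁺ (ψ ∷ B) {suc i} p = there (∈-satisfiedSubset⁺ B p)

    ∈-satisfiedSubset⁻ : ∀ {m} (B : Basis n m) {i} → i ∈ satisfiedSubset B → w ⊨ lookup B i
    ∈-satisfiedSubset⁻ (ψ ∷ B) {zero} i∈ with em {w ⊨ ψ} | i∈
    ... | yes p | _ = p
    ... | no _  | ()
    ∈-satisfiedSubset⁻ (ψ ∷ B) {suc i} (there i∈) = ∈-satisfiedSubset⁻ B i∈

    inContext-satisfiedSubset : ∀ {m} (B : Basis n m) → InContext B (satisfiedSubset B) w
    inContext-satisfiedSubset B i =
      ∈-satisfiedSubset⁻ B , λ i∉ p → i∉ (∈-satisfiedSubset⁺ B p)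

lemma4p3 : ExcludedMiddle 0ℓ →
    {n m : ℕ} (φ : LTL n) (B : Basis n m) (φ_ : Subset m → LTL n) →
    (∀ C → EquivUnder B C φ (φ_ C)) →
    (∀ C C′ → C ⊆ C′ → φ_ C ⊨ₗ φ_ C′) →
    φ ≡ₗ decomposition B φ_
lemma4p3 em {m = m} φ B φ_ equiv mono w = φ⇒decomposition , decomposition⇒φ
  where
    Cw = satisfiedSubset w em B
    φ⇔φ_Cw = equiv Cw w (inContext-satisfiedSubset w em B)
    disjunct = λ C → φ_ C ∧ₗ ⋀ (selected B C)

    φ⇒decomposition : w ⊨ φ → w ⊨ decomposition B φ_
    φ⇒decomposition p = ⊨⋁⁺ w (map⁺ (lose (∈-allSubsets Cw)
      (proj₁ φ⇔φ_Cw p , ⊨⋀-selected⁺ w B Cw (∈-satisfiedSubset⁻ w em B))))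

    decomposition⇒φ : w ⊨ decomposition B φ_ → w ⊨ φ
    decomposition⇒φ p with satisfied (map⁻ (⊨⋁⁻ w (map disjunct (allSubsets m)) p))
    ... | C , φ_C , ⋀C = proj₂ φ⇔φ_Cw (mono C Cw C⊆Cw w φ_C)
      where
        C⊆Cw : C ⊆ Cw
        C⊆Cw i∈C = ∈-satisfiedSubset⁺ w em B (⊨⋀-selected⁻ w B C ⋀C i∈C)
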